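{- Let $\mathcal{F}$ be a hereditary graph class and $\ell\ge 5$. If $G$ is a dynamically $\ell$-minimal graph in $\mathcal{F}$ and $u$ is a vertex of $G$ lying on a triangle of $G$, then $d_G(u)\ge \ell$.
   Context: All graphs are simple and finite; $d_G(u)$ is the degree of $u$ in $G$. A graph class is hereditary if it is closed under taking subgraphs. A proper coloring is dynamic if every vertex of degree at least two has at least two distinct colors among its neighbors. $G$ is dynamically $\ell$-choosable if for every list assignment $L$ with $|L(v)|=\ell$ for all $v$ there is a dynamic coloring $c$ with $c(v)\in L(v)$ for all $v$. $G$ is dynamically $\ell$-minimal in $\mathcal{F}$ if $G\in\mathcal{F}$, $G$ is not dynamically $\ell$-choosable, and every $H\in\mathcal{F}$ with $|V(H)|+|E(H)|<|V(G)|+|E(G)|$ is dynamically $\ell$-choosable. -}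

module Defs where

open import Data.Nat using (ℕ; _+_; _≤_; _<_)
open import Data.Bool using (Bool; true; false; if_then_else_)
open import Data.Fin using (Fin; toℕ)
open import Data.List using (List; length; map)
open import Data.Nat.ListAction using (sum)
open import Data.List.Membership.Propositional using (_∈_)
open import Data.List.Relation.Unary.Unique.Propositional using (Unique)
open import Data.Fin using (_<?_)
open import Data.List using (allFin)
open import Relation.Nullary.Decidable using (does)
open import Relation.Binary.PropositionalEquality using (_≡_; _≢_)
open import Data.Product using (Σ; ∃; _×_)
open import Function.Definitions using (Injective)

record Graph : Set where
  field
    order  : ℕ
    adj    : Fin order → Fin order → Bool
    sym    : ∀ u v → adj u v ≡ adj v u
    irrefl : ∀ v → adj v v ≡ false
open Graph public

Adj : (G : Graph) → Fin (order G) → Fin (order G) → Set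
Adj G u v = adj G u v ≡ true

deg : (G : Graph) → Fin (order G) → ℕ
deg G v = sum (map (λ u → if adj G v u then 1 else 0) (allFin (order G)))

edgeCount : Graph → ℕ
edgeCount G = sum (map (λ u → sum (map (λ w → if does (u <? w) then (if adj G u w then 1 else 0) else 0)
                                       (allFin (order G))))
                       (allFin (order G)))

size : Graph → ℕ
size G = order G + edgeCount G

-- H is (isomorphic to) a subgraph of G: an injective vertex map preserving edges
_⊆G_ : Graph → Graph → Set
H ⊆G G = Σ (Fin (order H) → Fin (order G)) λ f →
           Injective _≡_ _≡_ f × (∀ u v → Adj H u v → Adj G (f u) (f v))

GraphClass : Set₁
GraphClass = Graph → Set

Hereditary : GraphClass → Set
Hereditary 𝓕 = ∀ G H → H ⊆G G → 𝓕 G → 𝓕 H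

ListAssignment : ℕ → Graph → Set
ListAssignment ℓ G = (v : Fin (order G)) → Σ (List ℕ) λ xs → length xs ≡ ℓ × Unique xs

Proper : (G : Graph) → (Fin (order G) → ℕ) → Set
Proper G c = ∀ u v → Adj G u v → c u ≢ c v

DynamicCond : (G : Graph) → (Fin (order G) → ℕ) → Set
DynamicCond G c = ∀ v → 2 ≤ deg G v →
  ∃ λ u → ∃ λ w → Adj G v u × Adj G v w × c u ≢ c w

DynamicColoring : (G : Graph) → (Fin (order G) → ℕ) → Set
DynamicColoring G c = Proper G c × DynamicCond G c

DynChoosable : ℕ → Graph → Set
DynChoosable ℓ G = (L : ListAssignment ℓ G) →
  Σ (Fin (order G) → ℕ) λ c → DynamicColoring G c × (∀ v → c v ∈ Data.Product.proj₁ (L v))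

DynMinimal : ℕ → GraphClass → Graph → Set
DynMinimal ℓ 𝓕 G = 𝓕 G × (DynChoosable ℓ G → Data.Empty.⊥)
  × (∀ H → 𝓕 H → size H < size G → DynChoosable ℓ H)
  where import Data.Empty

OnTriangle : (G : Graph) → Fin (order G) → Set
OnTriangle G u = ∃ λ v → ∃ λ w → Adj G u v × Adj G v w × Adj G u w

module Submission where

-- Suppose deg u < ℓ.  Let H be G with all edges at u deleted; H is a proper
-- subgraph of G in the class, so by minimality it has a dynamic L-colouring c.
-- Extend c to G: give u a colour a ∈ L(u) avoiding, for every neighbour x
-- of u, the colour c(x) — or c(y) when y is the unique H-neighbour of x.
-- This is possible since deg u < ℓ.  A neighbour x of u coloured a then has
-- exactly one H-neighbour y; recolour it from L(x) avoiding a, c(y) and the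
-- two colours that witness the dynamic condition at y in H (at most four
-- colours, fewer than ℓ ≥ 5).  The result is a dynamic L-colouring of G; at u
-- the dynamic condition holds because the other two triangle vertices are
-- adjacent.  This contradicts that G is not dynamically ℓ-choosable.

open import Defs hiding (sym)
open import Data.Nat using (ℕ; zero; suc; _≤_; _<_; z≤n; s≤s; _≤?_; _≟_)
open import Data.Nat.Properties
  using (≤-refl; ≤-trans; ≤-reflexive; ≤-antisym; ≤-pred; ≤-irrelevant; ≰⇒>;
         +-mono-≤; +-mono-<-≤; +-mono-≤-<; +-monoʳ-<; +-suc; m≤n+m)
open import Data.Fin as Fin using (Fin; zero; suc; toℕ; _<?_)
open import Data.Fin.Properties using (suc-injective; <-cmp) renaming (_≟_ to _≟ᶠ_)
open import Data.Bool using (Bool; true; false; if_then_else_)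
open import Data.List using (List; []; _∷_; length; map; tabulate; allFin)
open import Data.List.Properties using (length-map; map-tabulate)
open import Data.Nat.ListAction using (sum)
open import Data.List.Membership.Propositional using (_∈_; _∉_)
open import Data.List.Membership.Propositional.Properties using (∈-map⁺; ∈-allFin)
open import Data.List.Relation.Unary.Any using (here; there; any?)
open import Data.List.Relation.Unary.All using () renaming (lookup to All-lookup)
open import Data.List.Relation.Unary.Unique.Propositional using (Unique)
open import Data.List.Relation.Unary.AllPairs.Core using (_∷_)
open import Data.Product using (∃; _×_; _,_; proj₁; proj₂)
open import Data.Empty using (⊥-elim)
open import Relation.Nullary using (¬_; yes; no; does)
open import Relation.Nullary.Decidable using (dec-true)
open import Relation.Binary using (DecidableEquality; Tri; tri<; tri≈; tri>)
open import Relation.Binary.PropositionalEquality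
  using (_≡_; _≢_; refl; sym; trans; cong; subst; subst₂)

module _ {A : Set} (_≟ᴬ_ : DecidableEquality A) where

  remove : A → List A → List A
  remove x [] = []
  remove x (y ∷ ys) with x ≟ᴬ y
  ... | yes _ = ys
  ... | no _ = y ∷ remove x ys

  remove-length : ∀ {x} ys → x ∈ ys → suc (length (remove x ys)) ≡ length ys
  remove-length {x} (y ∷ ys) x∈ with x ≟ᴬ y | x∈
  ... | yes _ | _ = refl
  ... | no x≢y | here x≡y = ⊥-elim (x≢y x≡y)
  ... | no _ | there x∈ys = cong suc (remove-length ys x∈ys)

  remove-keeps : ∀ {x z} ys → z ≢ x → z ∈ ys → z ∈ remove x ys
  remove-keeps {x} (y ∷ ys) z≢x z∈ with x ≟ᴬ y | z∈
  ... | yes x≡y | here z≡y = ⊥-elim (z≢x (trans z≡y (sym x≡y)))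
  ... | yes _ | there z∈ys = z∈ys
  ... | no _ | here z≡y = here z≡y
  ... | no _ | there z∈ys = there (remove-keeps ys z≢x z∈ys)

  avoid : ∀ {xs} → Unique xs → (ys : List A) → length ys < length xs →
          ∃ λ z → z ∈ xs × z ∉ ys
  avoid {x ∷ xs} (x∉xs ∷ xs-unique) ys ys<xs with any? (x ≟ᴬ_) ys
  ... | no x∉ys = x , here refl , x∉ys
  ... | yes x∈ys with avoid xs-unique (remove x ys) shorter
    where
    shorter : length (remove x ys) < length xs
    shorter = subst (_≤ length xs) (sym (remove-length ys x∈ys)) (≤-pred ys<xs)
  ... | z , z∈xs , z∉ = z , there z∈xs , λ z∈ys → z∉ (remove-keeps ys z≢x z∈ys)
    where
    z≢x : z ≢ x
    z≢x z≡x = All-lookup x∉xs z∈xs (sym z≡x)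

sum-map-mono : ∀ {A : Set} (f g : A → ℕ) xs → (∀ x → f x ≤ g x) →
               sum (map f xs) ≤ sum (map g xs)
sum-map-mono f g [] f≤g = z≤n
sum-map-mono f g (x ∷ xs) f≤g = +-mono-≤ (f≤g x) (sum-map-mono f g xs f≤g)

sum-map-strict : ∀ {A : Set} (f g : A → ℕ) {x xs} → (∀ x → f x ≤ g x) →
                 x ∈ xs → f x < g x → sum (map f xs) < sum (map g xs)
sum-map-strict f g {xs = y ∷ ys} f≤g (here refl) fx<gx =
  +-mono-<-≤ fx<gx (sum-map-mono f g ys f≤g)
sum-map-strict f g {xs = y ∷ ys} f≤g (there x∈ys) fx<gx =
  +-mono-≤-< (f≤g y) (sum-map-strict f g f≤g x∈ys fx<gx)

ind : Bool → ℕ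
ind b = if b then 1 else 0

ind≤1 : ∀ b → ind b ≤ 1
ind≤1 true = ≤-refl
ind≤1 false = z≤n

ind-mono : ∀ {b b′} → (b ≡ true → b′ ≡ true) → ind b ≤ ind b′
ind-mono {true} b⇒b′ rewrite b⇒b′ refl = ≤-refl
ind-mono {false} b⇒b′ = z≤n

count : ∀ {n} → (Fin n → Bool) → ℕ
count f = sum (tabulate (λ i → ind (f i)))

count-mono : ∀ {n} (f g : Fin n → Bool) → (∀ i → f i ≡ true → g i ≡ true) →
             count f ≤ count g
count-mono {zero} f g f⇒g = z≤n
count-mono {suc n} f g f⇒g =
  +-mono-≤ (ind-mono (f⇒g zero)) (count-mono (λ i → f (suc i)) (λ i → g (suc i)) (λ i → f⇒g (suc i)))

count-except : ∀ {n} (f g : Fin n → Bool) k → (∀ i → i ≢ k → f i ≡ true → g i ≡ true) →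
               count f ≤ suc (count g)
count-except {suc n} f g zero f⇒g =
  ≤-trans (+-mono-≤ (ind≤1 (f zero)) (count-mono (λ i → f (suc i)) (λ i → g (suc i)) (λ i → f⇒g (suc i) λ ())))
          (s≤s (m≤n+m _ (ind (g zero))))
count-except {suc n} f g (suc k) f⇒g =
  ≤-trans (+-mono-≤ (ind-mono (f⇒g zero λ ()))
                    (count-except (λ i → f (suc i)) (λ i → g (suc i)) k
                                  (λ i i≢k → f⇒g (suc i) (λ si≡sk → i≢k (suc-injective si≡sk)))))
          (≤-reflexive (+-suc (ind (g zero)) _))

witness : ∀ {n} (f : Fin n → Bool) → 1 ≤ count f → ∃ λ i → f i ≡ true
witness {suc n} f pos with f zero in f0
... | true = zero , f0
... | false with witness (λ i → f (suc i)) pos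
... | i , fi = suc i , fi

count-pos : ∀ {n} (f : Fin n → Bool) i → f i ≡ true → 1 ≤ count f
count-pos {suc n} f zero fi rewrite fi = s≤s z≤n
count-pos {suc n} f (suc i) fi = ≤-trans (count-pos (λ j → f (suc j)) i fi) (m≤n+m _ (ind (f zero)))

count-two : ∀ {n} (f : Fin n → Bool) i j → i ≢ j → f i ≡ true → f j ≡ true → 2 ≤ count f
count-two {suc n} f zero zero i≢j _ _ = ⊥-elim (i≢j refl)
count-two {suc n} f zero (suc j) _ fi fj rewrite fi = s≤s (count-pos (λ k → f (suc k)) j fj)
count-two {suc n} f (suc i) zero _ fi fj rewrite fj = s≤s (count-pos (λ k → f (suc k)) i fi)
count-two {suc n} f (suc i) (suc j) i≢j fi fj =
  ≤-trans (count-two (λ k → f (suc k)) i j (λ i≡j → i≢j (cong suc i≡j)) fi fj) (m≤n+m _ (ind (f zero)))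

count-one : ∀ {n} (f : Fin n → Bool) → count f ≡ 1 →
            ∃ λ i → f i ≡ true × (∀ j → f j ≡ true → j ≡ i)
count-one f one = i , fi , unique
  where
  i = proj₁ (witness f (≤-reflexive (sym one)))
  fi = proj₂ (witness f (≤-reflexive (sym one)))
  unique : ∀ j → f j ≡ true → j ≡ i
  unique j fj with j ≟ᶠ i
  ... | yes j≡i = j≡i
  ... | no j≢i with ≤-trans (count-two f j i j≢i fj fi) (≤-reflexive one)
  ...   | s≤s ()

trues : ∀ {n} → (Fin n → Bool) → List (Fin n)
trues {zero} f = []
trues {suc n} f = if f zero then zero ∷ rest else rest
  where rest = map suc (trues (λ i → f (suc i)))

length-trues : ∀ {n} (f : Fin n → Bool) → length (trues f) ≡ count f
length-trues {zero} f = refl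
length-trues {suc n} f with f zero
... | true = cong suc (trans (length-map Fin.suc (trues (λ i → f (suc i)))) (length-trues (λ i → f (suc i))))
... | false = trans (length-map Fin.suc (trues (λ i → f (suc i)))) (length-trues (λ i → f (suc i)))

∈-trues : ∀ {n} (f : Fin n → Bool) i → f i ≡ true → i ∈ trues f
∈-trues {suc n} f zero fi rewrite fi = here refl
∈-trues {suc n} f (suc i) fi with f zero
... | true = there (∈-map⁺ suc (∈-trues (λ j → f (suc j)) i fi))
... | false = ∈-map⁺ suc (∈-trues (λ j → f (suc j)) i fi)

module _ (G : Graph) where

  adj-sym : ∀ {s t} → Adj G s t → Adj G t s
  adj-sym {s} {t} st = trans (Graph.sym G t s) st

  adj⇒≢ : ∀ {s t} → Adj G s t → s ≢ t
  adj⇒≢ {s} st refl with trans (sym st) (Graph.irrefl G s)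
  ... | ()

  deg≡count : ∀ v → deg G v ≡ count (adj G v)
  deg≡count v = cong sum (map-tabulate (λ i → i) (λ w → ind (adj G v w)))

  sole-neighbour : ∀ x → deg G x ≡ 1 → ∃ λ y → Adj G x y × (∀ z → Adj G x z → z ≡ y)
  sole-neighbour x one = count-one (adj G x) (trans (sym (deg≡count x)) one)

-- The edge count of an arbitrary adjacency matrix (edgeCount G is by definition
-- pairCount (adj G)); deleting at least one edge makes it strictly smaller.
pairEntry : ∀ {n} → (Fin n → Fin n → Bool) → Fin n → Fin n → ℕ
pairEntry a s w = if does (s <? w) then ind (a s w) else 0

pairRow : ∀ {n} → (Fin n → Fin n → Bool) → Fin n → ℕ
pairRow {n} a s = sum (map (pairEntry a s) (allFin n))

pairCount : ∀ {n} → (Fin n → Fin n → Bool) → ℕ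
pairCount {n} a = sum (map (pairRow a) (allFin n))

pairCount-strict : ∀ {n} (a b : Fin n → Fin n → Bool) → (∀ s w → a s w ≡ true → b s w ≡ true) →
                   ∀ s w → toℕ s < toℕ w → b s w ≡ true → a s w ≡ false →
                   pairCount a < pairCount b
pairCount-strict {n} a b a⇒b s w s<w bsw asw =
  sum-map-strict (pairRow a) (pairRow b) row-mono (∈-allFin s)
    (sum-map-strict (pairEntry a s) (pairEntry b s) (entry-mono s) (∈-allFin w) entry-strict)
  where
  entry-mono : ∀ s w → pairEntry a s w ≤ pairEntry b s w
  entry-mono s w with does (s <? w)
  ... | true = ind-mono (a⇒b s w)
  ... | false = z≤n
  row-mono : ∀ s → pairRow a s ≤ pairRow b s
  row-mono s = sum-map-mono (pairEntry a s) (pairEntry b s) (allFin n) (entry-mono s)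
  entry-strict : pairEntry a s w < pairEntry b s w
  entry-strict rewrite dec-true (s <? w) s<w | asw | bsw = s≤s z≤n

module Isolate (G : Graph) (u : Fin (order G)) where

  isolatedAdj : Fin (order G) → Fin (order G) → Bool
  isolatedAdj s t = if does (s ≟ᶠ u) then false else if does (t ≟ᶠ u) then false else adj G s t

  isolatedAdj-sym : ∀ s t → isolatedAdj s t ≡ isolatedAdj t s
  isolatedAdj-sym s t with s ≟ᶠ u | t ≟ᶠ u
  ... | yes _ | yes _ = refl
  ... | yes _ | no _ = refl
  ... | no _ | yes _ = refl
  ... | no _ | no _ = Graph.sym G s t

  isolatedAdj-irrefl : ∀ v → isolatedAdj v v ≡ false
  isolatedAdj-irrefl v with v ≟ᶠ u
  ... | yes _ = refl
  ... | no _ = Graph.irrefl G v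

  H : Graph
  H = record { order = order G ; adj = isolatedAdj
             ; sym = isolatedAdj-sym ; irrefl = isolatedAdj-irrefl }

  H-edge⁻ : ∀ {s t} → Adj H s t → s ≢ u × t ≢ u × Adj G s t
  H-edge⁻ {s} {t} st with s ≟ᶠ u | t ≟ᶠ u
  H-edge⁻ () | yes _ | _
  H-edge⁻ () | no _ | yes _
  ... | no s≢u | no t≢u = s≢u , t≢u , st

  H-edge⁺ : ∀ {s t} → s ≢ u → t ≢ u → Adj G s t → Adj H s t
  H-edge⁺ {s} {t} s≢u t≢u st with s ≟ᶠ u | t ≟ᶠ u
  ... | yes s≡u | _ = ⊥-elim (s≢u s≡u)
  ... | no _ | yes t≡u = ⊥-elim (t≢u t≡u)
  ... | no _ | no _ = st

  H-edge⇒G-edge : ∀ {s t} → Adj H s t → Adj G s t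
  H-edge⇒G-edge st = proj₂ (proj₂ (H-edge⁻ st))

  H⊆G : H ⊆G G
  H⊆G = (λ x → x) , (λ eq → eq) , λ s t → H-edge⇒G-edge

  isolated : ∀ t → isolatedAdj u t ≡ false
  isolated t with u ≟ᶠ u
  ... | yes _ = refl
  ... | no u≢u = ⊥-elim (u≢u refl)

  size-H : ∀ {v} → Adj G u v → size H < size G
  size-H {v} uv = +-monoʳ-< (order G) (fewer-edges (<-cmp u v))
    where
    fewer-edges : Tri (toℕ u < toℕ v) (u ≡ v) (toℕ v < toℕ u) → edgeCount H < edgeCount G
    fewer-edges (tri< u<v _ _) =
      pairCount-strict isolatedAdj (adj G) (λ s t → H-edge⇒G-edge) u v u<v uv (isolated v)
    fewer-edges (tri≈ _ u≡v _) = ⊥-elim (adj⇒≢ G uv u≡v)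
    fewer-edges (tri> _ _ v<u) =
      pairCount-strict isolatedAdj (adj G) (λ s t → H-edge⇒G-edge) v u v<u (adj-sym G uv)
        (trans (isolatedAdj-sym v u) (isolated v))

  deg-H-≤ : ∀ {t} → t ≢ u → deg G t ≤ suc (deg H t)
  deg-H-≤ {t} t≢u =
    subst₂ (λ m k → m ≤ suc k) (sym (deg≡count G t)) (sym (deg≡count H t))
      (count-except (adj G t) (isolatedAdj t) u (λ i i≢u → H-edge⁺ t≢u i≢u))

  deg-H-nonadj : ∀ {t} → t ≢ u → adj G t u ≡ false → deg G t ≤ deg H t
  deg-H-nonadj {t} t≢u tu =
    subst₂ _≤_ (sym (deg≡count G t)) (sym (deg≡count H t))
      (count-mono (adj G t) (isolatedAdj t) (λ i ti → H-edge⁺ t≢u (i≢u i ti) ti))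
    where
    i≢u : ∀ i → Adj G t i → i ≢ u
    i≢u i ti refl with trans (sym ti) tu
    ... | ()

module Extension (ℓ : ℕ) (5≤ℓ : 5 ≤ ℓ) (G : Graph) (u : Fin (order G))
                 (triangle : OnTriangle G u) (deg<ℓ : deg G u < ℓ) where
  open Isolate G u

  module Recolour (L : ListAssignment ℓ G) (c : Fin (order G) → ℕ)
                  (c-dynamic : DynamicColoring H c) (c-in-L : ∀ v → c v ∈ proj₁ (L v)) where

    c-proper : Proper H c
    c-proper = proj₁ c-dynamic

    c-witnesses : DynamicCond H c
    c-witnesses = proj₂ c-dynamic

    fresh : ∀ x (forbidden : List ℕ) → length forbidden < ℓ →
            ∃ λ z → z ∈ proj₁ (L x) × z ∉ forbidden
    fresh x forbidden short =
      avoid _≟_ (proj₂ (proj₂ (L x))) forbidden (subst (length forbidden <_) (sym (proj₁ (proj₂ (L x)))) short)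

    partner : Fin (order G) → Fin (order G)
    partner x with deg H x ≟ 1
    ... | yes one = proj₁ (sole-neighbour H x one)
    ... | no _ = x

    partner-adj : ∀ x → deg H x ≡ 1 → Adj H x (partner x)
    partner-adj x one with deg H x ≟ 1
    ... | yes one′ = proj₁ (proj₂ (sole-neighbour H x one′))
    ... | no not-one = ⊥-elim (not-one one)

    partner-unique : ∀ x {y} → deg H x ≡ 1 → Adj H x y → y ≡ partner x
    partner-unique x {y} one xy with deg H x ≟ 1
    ... | yes one′ = proj₂ (proj₂ (sole-neighbour H x one′)) y xy
    ... | no not-one = ⊥-elim (not-one one)

    partner-self : ∀ x → deg H x ≢ 1 → partner x ≡ x
    partner-self x not-one with deg H x ≟ 1
    ... | yes one = ⊥-elim (not-one one)
    ... | no _ = refl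

    blocked : List ℕ
    blocked = map (λ x → c (partner x)) (trues (adj G u))

    blocked-short : length blocked < ℓ
    blocked-short = subst (_< ℓ) (sym length-blocked) deg<ℓ
      where
      length-blocked : length blocked ≡ deg G u
      length-blocked = trans (length-map _ (trues (adj G u)))
                             (trans (length-trues (adj G u)) (sym (deg≡count G u)))

    a : ℕ
    a = proj₁ (fresh u blocked blocked-short)

    a∈L : a ∈ proj₁ (L u)
    a∈L = proj₁ (proj₂ (fresh u blocked blocked-short))

    a-avoids-partners : ∀ {x} → Adj G u x → c (partner x) ≢ a
    a-avoids-partners {x} ux ca = proj₂ (proj₂ (fresh u blocked blocked-short))
      (subst (_∈ blocked) ca (∈-map⁺ (λ y → c (partner y)) (∈-trues (adj G u) x ux)))

    -- A neighbour of u coloured a has a unique H-neighbour, namely its partner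
    -- (otherwise it would be its own partner, and a avoids its colour).
    clash-degree-one : ∀ {x} → Adj G u x → c x ≡ a → deg H x ≡ 1
    clash-degree-one {x} ux cx with deg H x ≟ 1
    ... | yes one = one
    ... | no not-one = ⊥-elim (a-avoids-partners ux (trans (cong c (partner-self x not-one)) cx))

    clash-partner : ∀ {x y} → Adj G u x → c x ≡ a → Adj H x y → y ≡ partner x
    clash-partner {x} ux cx xy = partner-unique x (clash-degree-one ux cx) xy

    seen : Fin (order G) → List ℕ
    seen y with 2 ≤? deg H y
    ... | yes two = c (proj₁ (c-witnesses y two)) ∷ c (proj₁ (proj₂ (c-witnesses y two))) ∷ []
    ... | no _ = []

    seen-short : ∀ y → length (seen y) ≤ 2
    seen-short y with 2 ≤? deg H y
    ... | yes _ = ≤-refl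
    ... | no _ = z≤n

    seen-witnesses : ∀ y (two : 2 ≤ deg H y) →
                     c (proj₁ (c-witnesses y two)) ∈ seen y × c (proj₁ (proj₂ (c-witnesses y two))) ∈ seen y
    seen-witnesses y two with 2 ≤? deg H y
    ... | yes two′ rewrite ≤-irrelevant two two′ = here refl , there (here refl)
    ... | no not-two = ⊥-elim (not-two two)

    -- The new colour b(x) of a neighbour x coloured a: at most four colours are
    -- forbidden, and ℓ ≥ 5.
    forbidden : Fin (order G) → List ℕ
    forbidden x = a ∷ c (partner x) ∷ seen (partner x)

    b-choice : ∀ x → ∃ λ z → z ∈ proj₁ (L x) × z ∉ forbidden x
    b-choice x = fresh x (forbidden x) (≤-trans (s≤s (s≤s (s≤s (seen-short (partner x))))) 5≤ℓ)

    b : Fin (order G) → ℕ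
    b x = proj₁ (b-choice x)

    b≢a : ∀ x → b x ≢ a
    b≢a x e = proj₂ (proj₂ (b-choice x)) (here e)

    b-avoids-partner : ∀ {x y} → Adj G u x → c x ≡ a → Adj H x y → b x ≢ c y
    b-avoids-partner {x} ux cx xy e =
      proj₂ (proj₂ (b-choice x)) (there (here (trans e (cong c (clash-partner ux cx xy)))))

    b-avoids-seen : ∀ {x t z} → Adj G u x → c x ≡ a → Adj H x t → z ∈ seen t → b x ≢ z
    b-avoids-seen {x} ux cx xt z∈ refl =
      proj₂ (proj₂ (b-choice x)) (there (there (subst (λ y → b x ∈ seen y) (clash-partner ux cx xt) z∈)))

    data Role (x : Fin (order G)) : Set where
      centre     : x ≡ u → Role x
      recoloured : Adj G u x → c x ≡ a → Role x
      kept       : x ≢ u → (Adj G u x → c x ≢ a) → Role x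

    role : ∀ x → Role x
    role x with x ≟ᶠ u | adj G u x in ux | c x ≟ a
    ... | yes x≡u | _ | _ = centre x≡u
    ... | no _ | true | yes cx = recoloured ux cx
    ... | no x≢u | true | no cx = kept x≢u (λ _ → cx)
    ... | no x≢u | false | _ = kept x≢u (λ ux′ → ⊥-elim (false≢true (trans (sym ux) ux′)))
      where
      false≢true : false ≢ true
      false≢true ()

    colourAs : ∀ x → Role x → ℕ
    colourAs x (centre _) = a
    colourAs x (recoloured _ _) = b x
    colourAs x (kept _ _) = c x

    c′ : Fin (order G) → ℕ
    c′ x = colourAs x (role x)

    c′-centre : c′ u ≡ a
    c′-centre with role u
    ... | centre _ = refl
    ... | recoloured uu _ = ⊥-elim (adj⇒≢ G uu refl)
    ... | kept u≢u _ = ⊥-elim (u≢u refl)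

    c′-kept : ∀ {x} → x ≢ u → c x ≢ a → c′ x ≡ c x
    c′-kept {x} x≢u cx≢a with role x
    ... | centre x≡u = ⊥-elim (x≢u x≡u)
    ... | recoloured _ cx = ⊥-elim (cx≢a cx)
    ... | kept _ _ = refl

    neighbour≢u : ∀ {x} → Adj G u x → x ≢ u
    neighbour≢u ux x≡u = adj⇒≢ G ux (sym x≡u)

    centre-colour-free : ∀ {t} → Adj G u t → (r : Role t) → a ≢ colourAs t r
    centre-colour-free ut (centre t≡u) = ⊥-elim (neighbour≢u ut t≡u)
    centre-colour-free {t} ut (recoloured _ _) e = b≢a t (sym e)
    centre-colour-free ut (kept _ ct≢a) e = ct≢a ut (sym e)

    c′-proper : Proper G c′
    c′-proper s t st with role s | role t
    ... | centre s≡u | rt = centre-colour-free (subst (λ z → Adj G z t) s≡u st) rt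
    ... | rs | centre t≡u = λ e → centre-colour-free (adj-sym G (subst (Adj G s) t≡u st)) rs (sym e)
    ... | recoloured us cs | recoloured ut ct =
      ⊥-elim (c-proper s t (H-edge⁺ (neighbour≢u us) (neighbour≢u ut) st) (trans cs (sym ct)))
    ... | recoloured us cs | kept t≢u _ =
      b-avoids-partner us cs (H-edge⁺ (neighbour≢u us) t≢u st)
    ... | kept s≢u _ | recoloured ut ct =
      λ e → b-avoids-partner ut ct (H-edge⁺ (neighbour≢u ut) s≢u (adj-sym G st)) (sym e)
    ... | kept s≢u _ | kept t≢u _ = c-proper s t (H-edge⁺ s≢u t≢u st)

    DynamicAt : Fin (order G) → Set
    DynamicAt t = ∃ λ p → ∃ λ q → Adj G t p × Adj G t q × c′ p ≢ c′ q

    -- At u: the other two vertices of the triangle are adjacent, so they differ.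
    dynamic-centre : DynamicAt u
    dynamic-centre = let (v , w , uv , vw , uw) = triangle in v , w , uv , uw , c′-proper v w vw

    -- If deg_H t ≥ 2, the witnesses of c at t still witness c′.
    dynamic-H : ∀ t → 2 ≤ deg H t → DynamicAt t
    dynamic-H t two with c-witnesses t two | seen-witnesses t two
    ... | p , q , tp , tq , cp≢cq | cp∈ , cq∈ =
      p , q , H-edge⇒G-edge tp , H-edge⇒G-edge tq , distinct
      where
      distinct : c′ p ≢ c′ q
      distinct with role p | role q
      ... | centre p≡u | _ = ⊥-elim (proj₁ (proj₂ (H-edge⁻ {t} {p} tp)) p≡u)
      ... | _ | centre q≡u = ⊥-elim (proj₁ (proj₂ (H-edge⁻ {t} {q} tq)) q≡u)
      ... | recoloured _ cp | recoloured _ cq = ⊥-elim (cp≢cq (trans cp (sym cq)))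
      ... | recoloured up cp | kept _ _ = b-avoids-seen up cp (adj-sym H {t} {p} tp) cq∈
      ... | kept _ _ | recoloured uq cq = λ e → b-avoids-seen uq cq (adj-sym H {t} {q} tq) cp∈ (sym e)
      ... | kept _ _ | kept _ _ = cp≢cq

    -- If deg_G t ≥ 2 > deg_H t, then t is a neighbour of u with one H-neighbour
    -- y = partner t, and c′ u = a ≠ c y = c′ y.
    dynamic-pendant : ∀ t → t ≢ u → 2 ≤ deg G t → ¬ (2 ≤ deg H t) → DynamicAt t
    dynamic-pendant t t≢u two-G not-two-H with adj G t u in tu
    ... | false = ⊥-elim (not-two-H (≤-trans two-G (deg-H-nonadj t≢u tu)))
    ... | true = u , partner t , tu , H-edge⇒G-edge t-y , distinct
      where
      one : deg H t ≡ 1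
      one = ≤-antisym (≤-pred (≰⇒> not-two-H)) (≤-pred (≤-trans two-G (deg-H-≤ t≢u)))
      t-y : Adj H t (partner t)
      t-y = partner-adj t one
      cy≢a : c (partner t) ≢ a
      cy≢a = a-avoids-partners (adj-sym G tu)
      distinct : c′ u ≢ c′ (partner t)
      distinct e = cy≢a (trans (sym (c′-kept (proj₁ (proj₂ (H-edge⁻ {t} t-y))) cy≢a)) (trans (sym e) c′-centre))

    c′-dynamic : DynamicCond G c′
    c′-dynamic t two with t ≟ᶠ u
    ... | yes refl = dynamic-centre
    ... | no t≢u with 2 ≤? deg H t
    ...   | yes two-H = dynamic-H t two-H
    ...   | no not-two-H = dynamic-pendant t t≢u two not-two-H

    c′-in-L : ∀ x → c′ x ∈ proj₁ (L x)
    c′-in-L x with role x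
    ... | centre refl = a∈L
    ... | recoloured _ _ = proj₁ (proj₂ (b-choice x))
    ... | kept _ _ = c-in-L x

  extend : DynChoosable ℓ H → DynChoosable ℓ G
  extend H-choosable L with H-choosable L
  ... | c , c-dynamic , c-in-L = c′ , (c′-proper , c′-dynamic) , c′-in-L
    where open Recolour L c c-dynamic c-in-L

proposition4 : (𝓕 : GraphClass) → Hereditary 𝓕 → (ℓ : ℕ) → 5 ≤ ℓ →
    (G : Graph) → DynMinimal ℓ 𝓕 G → (u : Fin (order G)) → OnTriangle G u →
    ℓ ≤ deg G u
proposition4 𝓕 hereditary ℓ 5≤ℓ G (G∈𝓕 , G-not-choosable , minimal) u triangle
  with ℓ ≤? deg G u
... | yes ℓ≤deg = ℓ≤deg
... | no ℓ≰deg = ⊥-elim (G-not-choosable (extend H-choosable))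
  where
  open Isolate G u using (H; H⊆G; size-H)
  open Extension ℓ 5≤ℓ G u triangle (≰⇒> ℓ≰deg) using (extend)
  H-choosable : DynChoosable ℓ H
  H-choosable = minimal H (hereditary G H H⊆G G∈𝓕) (size-H (proj₁ (proj₂ (proj₂ triangle))))
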